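{- If $G$ is a block graph with blocks $B_1,B_2,\dots,B_\ell$, then $d_\Delta(G)=\ell+1$.
   Context: All graphs are finite, simple, undirected and connected. A block of $G$ is a maximal connected subgraph of $G$ without a cut vertex (so a bridge together with its ends is a block); $G$ is a block graph if every block is a complete graph. For $S\subseteq V(G)$, the $\Delta$-interval $[S]$ is the set consisting of all vertices of $S$ together with every vertex $v$ adjacent to both $x$ and $y$ for some pair of adjacent vertices $x,y\in S$. A set $S$ is $\Delta$-convex if $[S]=S$, and $\langle S\rangle$ denotes the smallest $\Delta$-convex set containing $S$ ($\langle\emptyset\rangle=\emptyset$). A set $S$ is convexly independent if $a\notin\langle S\setminus\{a\}\rangle$ for every $a\in S$. The rank $d_\Delta(G)$ is the least integer $n\ge0$ such that every $S\subseteq V(G)$ with $|S|>n$ is not convexly independent (equivalently, the maximum size of a convexly independent set). -}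

module Defs where

open import Data.Nat using (ℕ; suc; _≤_; _<_)
open import Data.Bool using (Bool; T)
open import Data.Fin using (Fin)
open import Data.Fin.Subset using (Subset; _∈_; _∉_; _⊆_; _⊂_; _-_; ⊤; ∣_∣)
open import Data.Product using (Σ; _×_; ∃)
open import Data.Sum using (_⊎_)
open import Relation.Nullary using (¬_)
open import Relation.Binary.PropositionalEquality using (_≡_; _≢_)

record Graph (n : ℕ) : Set where
  field
    adj   : Fin n → Fin n → Bool
    sym   : ∀ u v → adj u v ≡ adj v u
    irrefl : ∀ v → ¬ T (adj v v)

module _ {n : ℕ} (G : Graph n) where
  open Graph G

  Adj : Fin n → Fin n → Set
  Adj u v = T (adj u v)

  data Reach (P : Subset n) (u : Fin n) : Fin n → Set where
    here : u ∈ P → Reach P u u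
    step : ∀ {w v} → Reach P u w → Adj w v → v ∈ P → Reach P u v

  ConnectedOn : Subset n → Set
  ConnectedOn P = ∀ u v → u ∈ P → v ∈ P → Reach P u v

  Connected : Set
  Connected = ConnectedOn ⊤

  NoCutVertexOn : Subset n → Set
  NoCutVertexOn P = ∀ v → v ∈ P → ConnectedOn (P - v)

  Nonseparable : Subset n → Set
  Nonseparable P = ConnectedOn P × NoCutVertexOn P

  -- A block: a maximal connected subgraph without a cut vertex
  -- (represented by its vertex set; maximal such subgraphs are induced).
  IsBlock : Subset n → Set
  IsBlock B = Nonseparable B × (∀ C → B ⊂ C → ¬ Nonseparable C)

  IsBlockGraph : Set
  IsBlockGraph = ∀ B → IsBlock B → ∀ u v → u ∈ B → v ∈ B → u ≢ v → Adj u v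

  _∈Δ[_] : Fin n → Subset n → Set
  v ∈Δ[ S ] = v ∈ S ⊎ (Σ (Fin n) λ x → Σ (Fin n) λ y →
                 x ∈ S × y ∈ S × Adj x y × Adj v x × Adj v y)

  ΔConvex : Subset n → Set
  ΔConvex S = ∀ v → v ∈Δ[ S ] → v ∈ S

  _∈⟨_⟩ : Fin n → Subset n → Set
  v ∈⟨ S ⟩ = ∀ T → ΔConvex T → S ⊆ T → v ∈ T

  ConvexlyIndependent : Subset n → Set
  ConvexlyIndependent S = ∀ a → a ∈ S → ¬ (a ∈⟨ S - a ⟩)

  IsΔRank : ℕ → Set
  IsΔRank d = (∀ S → d < ∣ S ∣ → ¬ ConvexlyIndependent S)
            × (∀ m → m < d → ¬ (∀ S → m < ∣ S ∣ → ¬ ConvexlyIndependent S))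

-- Grow G block by block. Start from one vertex and, while some vertex is missing, follow an edge
-- cd leaving the current part U and extend it to a block D; since U is closed under blocks (a block
-- with two vertices in U lies in U), D meets U only in c and no edge joins U ∖ D to D ∖ U, so U ∪ D
-- is again connected and block-closed. After k blocks, a convexly independent S ⊆ U has at most
-- k + 1 elements: at most two of them lie in the clique D ∖ U, and two such can be traded for c.
-- Conversely, adding a vertex d ∈ D ∖ U to the independent set built so far keeps it independent,
-- as witnessed by block-closed (hence Δ-convex) sets separating each element from the others.
-- Every block is attached exactly once, so the process stops after ℓ steps.
--
-- Blocks are obtained only classically (as maximal nonseparable supersets), so the argument runs in
-- the double-negation monad; this is enough because both halves of IsΔRank are negative statements.

module Submission where

import Data.Bool as Bool
open import Data.Empty using (⊥; ⊥-elim)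
open import Data.Fin using (Fin; zero; suc; _≟_)
open import Data.Fin.Properties using (any?)
open import Data.Fin.Subset
  using (Subset; _∈_; _∉_; _⊆_; _⊂_; _-_; _─_; _∪_; ⁅_⁆; ∣_∣; inside; outside)
  renaming (⊥ to ∅)
open import Data.Fin.Subset.Properties
  using (_∈?_; ∈⊤; ∉⊥; ⊆⊤; ⊆-antisym; x∈⁅x⁆; x∈⁅y⁆⇒x≡y; ∣⁅x⁆∣≡1; ∣⊥∣≡0; ∣⊤∣≡n; ∣p∣≤n;
         p⊆q⇒∣p∣≤∣q∣; p⊂q⇒∣p∣<∣q∣; p⊆p∪q; q⊆p∪q; x∈p∪q⁻; ∪-identityʳ; p─⊥≡p; p─q⊆p;
         x∈p∧x≢y⇒x∈p-y)
open import Data.List using (List; []; _∷_; _++_; foldr)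
open import Data.List.Membership.Propositional using () renaming (_∈_ to _∈ˡ_; _∉_ to _∉ˡ_)
open import Data.List.Membership.Propositional.Properties using (∈-++⁺ˡ; ∈-++⁺ʳ; ∈-++⁻; ∈-∃++)
open import Data.List.Relation.Unary.Any using (here; there)
open import Data.List.Relation.Unary.All using ([]) renaming (lookup to All-lookup)
open import Data.List.Relation.Unary.All.Properties.Core using (¬Any⇒All¬)
open import Data.List.Relation.Unary.AllPairs using ([]; _∷_)
open import Data.List.Relation.Unary.Unique.Propositional using (Unique)
open import Data.Nat using (ℕ; zero; suc; _+_; _≤_; _<_; s≤s)
open import Data.Nat.Properties
  using (≤-trans; ≤-reflexive; <⇒≱; 1+n≰n; n≤1+n; m≤n+m; +-suc; +-identityʳ; +-monoˡ-≤)
open import Data.Product using (Σ; _×_; _,_; proj₁; proj₂; ∃; swap)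
open import Data.Vec using (_∷_; here; there)
open import Data.Sum using (_⊎_; inj₁; inj₂) renaming (map to ⊎-map)
open import Function using (_∘_; id)
open import Function.Definitions using (Injective)
open import Relation.Binary.PropositionalEquality
  using (_≡_; _≢_; refl; sym; trans; cong; subst; module ≡-Reasoning)
open import Relation.Nullary using (¬_; Dec; yes; no; ¬?)
open import Relation.Nullary.Decidable using (_×-dec_; decidable-stable; ¬¬-excluded-middle)
open import Relation.Nullary.Negation using (DoubleNegation; ¬¬-map)

open import Defs

x∈p─q⇒x∉q : ∀ {n} {x : Fin n} (p q : Subset n) → x ∈ p ─ q → x ∉ q
x∈p─q⇒x∉q (_ ∷ p) (inside  ∷ q) ()        here
x∈p─q⇒x∉q (_ ∷ p) (outside ∷ q) here      ()
x∈p─q⇒x∉q (_ ∷ p) (_       ∷ q) (there h) (there h′) = x∈p─q⇒x∉q p q h h′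

x∈p-y⇒x∈p : ∀ {n} {x y : Fin n} {p : Subset n} → x ∈ p - y → x ∈ p
x∈p-y⇒x∈p {y = y} {p = p} = p─q⊆p p ⁅ y ⁆

x∈p-y⇒x≢y : ∀ {n} {x y : Fin n} {p : Subset n} → x ∈ p - y → x ≢ y
x∈p-y⇒x≢y {y = y} {p = p} h refl = x∈p─q⇒x∉q p ⁅ y ⁆ h (x∈⁅x⁆ y)

p⊆q⇒p-x⊆q-x : ∀ {n} {x : Fin n} {p q : Subset n} → p ⊆ q → p - x ⊆ q - x
p⊆q⇒p-x⊆q-x p⊆q h = x∈p∧x≢y⇒x∈p-y (p⊆q (x∈p-y⇒x∈p h)) (x∈p-y⇒x≢y h)

∈-∪⁺ˡ : ∀ {n} {x : Fin n} {p q : Subset n} → x ∈ p → x ∈ p ∪ q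
∈-∪⁺ˡ {q = q} = p⊆p∪q q

∈-∪⁺ʳ : ∀ {n} {x : Fin n} {p q : Subset n} → x ∈ q → x ∈ p ∪ q
∈-∪⁺ʳ {p = p} {q = q} = q⊆p∪q p q

∈-∪⁻ : ∀ {n} {x : Fin n} {p q : Subset n} → x ∈ p ∪ q → x ∈ p ⊎ x ∈ q
∈-∪⁻ {p = p} {q = q} = x∈p∪q⁻ p q

∈⁅⁆-unique : ∀ {n} {x y v : Fin n} → x ∈ ⁅ v ⁆ → y ∈ ⁅ v ⁆ → x ≡ y
∈⁅⁆-unique {v = v} x∈ y∈ = trans (x∈⁅y⁆⇒x≡y v x∈) (sym (x∈⁅y⁆⇒x≡y v y∈))

x∈p⇒∣p∣≡1+∣p-x∣ : ∀ {n} {x : Fin n} {p : Subset n} → x ∈ p → ∣ p ∣ ≡ suc ∣ p - x ∣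
x∈p⇒∣p∣≡1+∣p-x∣ {x = zero}  {p = inside  ∷ p} here      = cong suc (sym (cong ∣_∣ (p─⊥≡p p)))
x∈p⇒∣p∣≡1+∣p-x∣ {x = suc x} {p = inside  ∷ p} (there h) = cong suc (x∈p⇒∣p∣≡1+∣p-x∣ h)
x∈p⇒∣p∣≡1+∣p-x∣ {x = suc x} {p = outside ∷ p} (there h) = x∈p⇒∣p∣≡1+∣p-x∣ h

x∉p⇒∣p∪⁅x⁆∣≡1+∣p∣ : ∀ {n} {x : Fin n} {p : Subset n} → x ∉ p → ∣ p ∪ ⁅ x ⁆ ∣ ≡ suc ∣ p ∣
x∉p⇒∣p∪⁅x⁆∣≡1+∣p∣ {x = zero}  {p = inside  ∷ p} x∉p = ⊥-elim (x∉p here)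
x∉p⇒∣p∪⁅x⁆∣≡1+∣p∣ {x = zero}  {p = outside ∷ p} x∉p = cong (suc ∘ ∣_∣) (∪-identityʳ p)
x∉p⇒∣p∪⁅x⁆∣≡1+∣p∣ {x = suc x} {p = inside  ∷ p} x∉p = cong suc (x∉p⇒∣p∪⁅x⁆∣≡1+∣p∣ (x∉p ∘ there))
x∉p⇒∣p∪⁅x⁆∣≡1+∣p∣ {x = suc x} {p = outside ∷ p} x∉p = x∉p⇒∣p∪⁅x⁆∣≡1+∣p∣ (x∉p ∘ there)

∀∈⇒∣p∣≡n : ∀ {n} {p : Subset n} → (∀ x → x ∈ p) → ∣ p ∣ ≡ n
∀∈⇒∣p∣≡n all = trans (cong ∣_∣ (⊆-antisym ⊆⊤ (λ {x} _ → all x))) (∣⊤∣≡n _)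

Unique-++⁻ʳ : ∀ {A : Set} (pre : List A) {xs} → Unique (pre ++ xs) → Unique xs
Unique-++⁻ʳ []        u       = u
Unique-++⁻ʳ (_ ∷ pre) (_ ∷ u) = Unique-++⁻ʳ pre u

Unique-split : ∀ {A : Set} {w z : A} pre {suf} → Unique (pre ++ z ∷ suf) → w ∈ˡ pre → w ∉ˡ suf
Unique-split (p ∷ pre) (p∉ ∷ _) (here refl)   w∈suf = All-lookup p∉ (∈-++⁺ʳ pre (there w∈suf)) refl
Unique-split (p ∷ pre) (_  ∷ u) (there w∈pre)       = Unique-split pre u w∈pre

module Walks {n : ℕ} (G : Graph n) where
  open Graph G using (irrefl) renaming (sym to adj-sym)
  open import Data.List.Membership.DecPropositional (_≟_ {n}) using () renaming (_∈?_ to _∈ˡ?_)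

  Adj-sym : ∀ {u v} → Adj G u v → Adj G v u
  Adj-sym {u} {v} = subst Bool.T (adj-sym u v)

  Adj⇒≢ : ∀ {u v} → Adj G u v → u ≢ v
  Adj⇒≢ {u} a refl = irrefl u a

  source∈ : ∀ {P u v} → Reach G P u v → u ∈ P
  source∈ (here u∈P)   = u∈P
  source∈ (step r _ _) = source∈ r

  Reach-mono : ∀ {P Q u v} → P ⊆ Q → Reach G P u v → Reach G Q u v
  Reach-mono P⊆Q (here u∈P)     = here (P⊆Q u∈P)
  Reach-mono P⊆Q (step r a v∈P) = step (Reach-mono P⊆Q r) a (P⊆Q v∈P)

  Reach-trans : ∀ {P u w v} → Reach G P u w → Reach G P w v → Reach G P u v
  Reach-trans r (here _)        = r
  Reach-trans r (step r′ a v∈P) = step (Reach-trans r r′) a v∈P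

  Reach-cons : ∀ {P u w v} → Adj G u w → u ∈ P → Reach G P w v → Reach G P u v
  Reach-cons a u∈P r = Reach-trans (step (here u∈P) a (source∈ r)) r

  Reach-sym : ∀ {P u v} → Reach G P u v → Reach G P v u
  Reach-sym (here u∈P)     = here u∈P
  Reach-sym (step r a v∈P) = Reach-cons (Adj-sym a) v∈P (Reach-sym r)

  Reach-last-edge : ∀ {P u v} → Reach G P u v → u ≢ v → Σ (Fin n) λ w → Adj G w v
  Reach-last-edge (here _)           u≢v = ⊥-elim (u≢v refl)
  Reach-last-edge (step {w} _ a _) _   = w , a

  Reach-exit : ∀ {P a b} U → Reach G P a b → a ∈ U → b ∉ U →
               Σ (Fin n) λ c → Σ (Fin n) λ d → c ∈ U × d ∉ U × Adj G c d
  Reach-exit U (here _)               a∈U b∉U = ⊥-elim (b∉U a∈U)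
  Reach-exit U (step {w} {b} r a _) a∈U b∉U with w ∈? U
  ... | yes w∈U = w , b , w∈U , b∉U , a
  ... | no  w∉U = Reach-exit U r a∈U w∉U

  Reach-until : ∀ {P a b} v → Reach G P a b → a ≢ v →
                Reach G (P - v) a b ⊎ Σ (Fin n) λ w → Reach G (P - v) a w × Adj G w v
  Reach-until v (here a∈P) a≢v = inj₁ (here (x∈p∧x≢y⇒x∈p-y a∈P a≢v))
  Reach-until v (step {w} {b} r a b∈P) a≢v with Reach-until v r a≢v
  ... | inj₂ hit = inj₂ hit
  ... | inj₁ r′ with b ≟ v
  ...   | yes refl = inj₂ (w , r′ , a)
  ...   | no  b≢v  = inj₁ (step r′ a (x∈p∧x≢y⇒x∈p-y b∈P b≢v))

  hub⇒ConnectedOn : ∀ {P} h → (∀ z → z ∈ P → Reach G P z h) → ConnectedOn G P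
  hub⇒ConnectedOn h to-h u v u∈P v∈P = Reach-trans (to-h u u∈P) (Reach-sym (to-h v v∈P))

  ConnectedOn-glue : ∀ {P Q R h} → ConnectedOn G P → ConnectedOn G Q → h ∈ P → h ∈ Q →
                     P ⊆ R → Q ⊆ R → R ⊆ P ∪ Q → ConnectedOn G R
  ConnectedOn-glue {h = h} cP cQ h∈P h∈Q P⊆R Q⊆R R⊆P∪Q = hub⇒ConnectedOn h to-h
    where
    to-h : ∀ z → z ∈ _ → Reach G _ z h
    to-h z z∈R with ∈-∪⁻ (R⊆P∪Q z∈R)
    ... | inj₁ z∈P = Reach-mono P⊆R (cP z h z∈P h∈P)
    ... | inj₂ z∈Q = Reach-mono Q⊆R (cQ z h z∈Q h∈Q)

  Chain : Fin n → List (Fin n) → Fin n → Set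
  Chain a []       b = Adj G a b
  Chain a (p ∷ ps) b = Adj G a p × Chain p ps b

  Chain-split : ∀ {a b} pre q suf → Chain a (pre ++ q ∷ suf) b → Chain a pre q × Chain q suf b
  Chain-split []        q suf (a , ch) = a , ch
  Chain-split (p ∷ pre) q suf (a , ch) with Chain-split pre q suf ch
  ... | ch₁ , ch₂ = (a , ch₁) , ch₂

  Chain-join : ∀ {a b} pre q suf → Chain a pre q → Chain q suf b → Chain a (pre ++ q ∷ suf) b
  Chain-join []        q suf a         ch₂ = a , ch₂
  Chain-join (p ∷ pre) q suf (a , ch₁) ch₂ = a , Chain-join pre q suf ch₁ ch₂

  Chain⇒Reach : ∀ {P a b} L → Chain a L b → a ∈ P → (∀ {q} → q ∈ˡ L → q ∈ P) → b ∈ P → Reach G P a b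
  Chain⇒Reach []      a        a∈P _   b∈P = step (here a∈P) a b∈P
  Chain⇒Reach (p ∷ L) (a , ch) a∈P L⊆P b∈P =
    Reach-cons a a∈P (Chain⇒Reach L ch (L⊆P (here refl)) (L⊆P ∘ there) b∈P)

  interior : ∀ {P u v} → Reach G P u v → List (Fin n)
  interior (here _)             = []
  interior (step {v = v} r _ _) = interior r ++ v ∷ []

  Reach⇒Chain : ∀ {P x u w v} (r : Reach G P u w) → Adj G x u → Adj G w v → Chain x (u ∷ interior r) v
  Reach⇒Chain (here _)                 xu wv = xu , wv
  Reach⇒Chain {u = u} (step {v = w} r a _) xu wv = Chain-join (u ∷ interior r) w [] (Reach⇒Chain r xu a) wv

  Reach-vertices : ∀ {P u w z} (r : Reach G P u w) → z ∈ˡ u ∷ interior r → z ∈ P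
  Reach-vertices r                  (here refl) = source∈ r
  Reach-vertices (here _)           (there ())
  Reach-vertices (step r _ v∈P) (there z∈) with ∈-++⁻ (interior r) z∈
  ... | inj₁ z∈r         = Reach-vertices r (there z∈r)
  ... | inj₂ (here refl) = v∈P

  -- Only closed detours are cut out, so the first vertex survives and a nonempty ear stays nonempty.
  Chain-shortcut : ∀ {a b} q L → Chain a (q ∷ L) b →
                   Σ (List (Fin n)) λ L′ → Chain a (q ∷ L′) b × Unique (q ∷ L′) ×
                                           (∀ {z} → z ∈ˡ q ∷ L′ → z ∈ˡ q ∷ L)
  Chain-shortcut q []      ch             = [] , ch , [] ∷ [] , id
  Chain-shortcut {b = b} q (r ∷ L) (aq , ch) with Chain-shortcut r L ch
  ... | L′ , ch′ , uniq′ , sub′ with q ∈ˡ? r ∷ L′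
  ...   | no q∉ = r ∷ L′ , (aq , ch′) , ¬Any⇒All¬ _ q∉ ∷ uniq′
                , λ { (here refl) → here refl ; (there z∈) → there (sub′ z∈) }
  ...   | yes q∈ with ∈-∃++ q∈
  ...     | pre , suf , eq =
            suf , (aq , proj₂ (Chain-split pre q suf (subst (λ M → Chain q M b) eq ch′)))
                , Unique-++⁻ʳ pre (subst Unique eq uniq′)
                , λ { (here refl) → here refl
                    ; (there z∈) → there (sub′ (subst (_ ∈ˡ_) (sym eq) (∈-++⁺ʳ pre (there z∈)))) }

module Blocks {n : ℕ} (G : Graph n) where
  open Walks G
  open import Data.List.Membership.DecPropositional (_≟_ {n}) using () renaming (_∈?_ to _∈ˡ?_)

  pair : Fin n → Fin n → Subset n
  pair u v = ⁅ u ⁆ ∪ ⁅ v ⁆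

  u∈pair : ∀ {u v} → u ∈ pair u v
  u∈pair {u} = ∈-∪⁺ˡ (x∈⁅x⁆ u)

  v∈pair : ∀ {u v} → v ∈ pair u v
  v∈pair {v = v} = ∈-∪⁺ʳ (x∈⁅x⁆ v)

  ∈-pair⁻ : ∀ {u v z} → z ∈ pair u v → z ≡ u ⊎ z ≡ v
  ∈-pair⁻ {u} {v} z∈ with ∈-∪⁻ z∈
  ... | inj₁ z∈u = inj₁ (x∈⁅y⁆⇒x≡y u z∈u)
  ... | inj₂ z∈v = inj₂ (x∈⁅y⁆⇒x≡y v z∈v)

  edge-ConnectedOn : ∀ {u v Y} → Adj G u v → Y ⊆ pair u v → ConnectedOn G Y
  edge-ConnectedOn a Y⊆ x y x∈Y y∈Y with ∈-pair⁻ (Y⊆ x∈Y) | ∈-pair⁻ (Y⊆ y∈Y)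
  ... | inj₁ refl | inj₁ refl = here x∈Y
  ... | inj₂ refl | inj₂ refl = here x∈Y
  ... | inj₁ refl | inj₂ refl = step (here x∈Y) a y∈Y
  ... | inj₂ refl | inj₁ refl = step (here x∈Y) (Adj-sym a) y∈Y

  edge-Nonseparable : ∀ {u v} → Adj G u v → Nonseparable G (pair u v)
  edge-Nonseparable a = edge-ConnectedOn a id , λ _ _ → edge-ConnectedOn a x∈p-y⇒x∈p

  Nonseparable⇒ConnectedOn-minus : ∀ {X} → Nonseparable G X → ∀ w → ConnectedOn G (X - w)
  Nonseparable⇒ConnectedOn-minus {X} (cX , noCut) w with w ∈? X
  ... | yes w∈X = noCut w w∈X
  ... | no  w∉X = λ a b a∈ b∈ → Reach-mono keep (cX a b (x∈p-y⇒x∈p a∈) (x∈p-y⇒x∈p b∈))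
    where
    keep : X ⊆ X - w
    keep z∈X = x∈p∧x≢y⇒x∈p-y z∈X λ { refl → w∉X z∈X }

  ∪-Nonseparable : ∀ {X Y x y} → Nonseparable G X → Nonseparable G Y →
                   x ∈ X → x ∈ Y → y ∈ X → y ∈ Y → x ≢ y → Nonseparable G (X ∪ Y)
  ∪-Nonseparable {X} {Y} {x} {y} nsX nsY x∈X x∈Y y∈X y∈Y x≢y =
    ConnectedOn-glue (proj₁ nsX) (proj₁ nsY) x∈X x∈Y ∈-∪⁺ˡ ∈-∪⁺ʳ id , no-cut
    where
    no-cut : NoCutVertexOn G (X ∪ Y)
    no-cut w _ =
      ConnectedOn-glue (Nonseparable⇒ConnectedOn-minus nsX w) (Nonseparable⇒ConnectedOn-minus nsY w)
                       (proj₁ (proj₂ hub)) (proj₂ (proj₂ hub)) (p⊆q⇒p-x⊆q-x ∈-∪⁺ˡ) (p⊆q⇒p-x⊆q-x ∈-∪⁺ʳ) split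
      where
      hub : Σ (Fin n) λ h → h ∈ X - w × h ∈ Y - w
      hub with x ≟ w
      ... | no  x≢w  = x , x∈p∧x≢y⇒x∈p-y x∈X x≢w , x∈p∧x≢y⇒x∈p-y x∈Y x≢w
      ... | yes refl = y , x∈p∧x≢y⇒x∈p-y y∈X (x≢y ∘ sym) , x∈p∧x≢y⇒x∈p-y y∈Y (x≢y ∘ sym)
      split : (X ∪ Y) - w ⊆ (X - w) ∪ (Y - w)
      split z∈ with ∈-∪⁻ (x∈p-y⇒x∈p z∈)
      ... | inj₁ z∈X = ∈-∪⁺ˡ (x∈p∧x≢y⇒x∈p-y z∈X (x∈p-y⇒x≢y z∈))
      ... | inj₂ z∈Y = ∈-∪⁺ʳ (x∈p∧x≢y⇒x∈p-y z∈Y (x∈p-y⇒x≢y z∈))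

  fromList : List (Fin n) → Subset n
  fromList = foldr (λ p s → ⁅ p ⁆ ∪ s) ∅

  ∈-fromList⁺ : ∀ {z} L → z ∈ˡ L → z ∈ fromList L
  ∈-fromList⁺ (p ∷ L) (here refl) = ∈-∪⁺ˡ (x∈⁅x⁆ p)
  ∈-fromList⁺ (p ∷ L) (there z∈L) = ∈-∪⁺ʳ (∈-fromList⁺ L z∈L)

  ∈-fromList⁻ : ∀ {z} L → z ∈ fromList L → z ∈ˡ L
  ∈-fromList⁻ []      z∈ = ⊥-elim (∉⊥ z∈)
  ∈-fromList⁻ (p ∷ L) z∈ with ∈-∪⁻ z∈
  ... | inj₁ z∈p = here (x∈⁅y⁆⇒x≡y p z∈p)
  ... | inj₂ z∈L = there (∈-fromList⁻ L z∈L)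

  module Ear {X u v} L (nsX : Nonseparable G X) (u∈X : u ∈ X) (v∈X : v ∈ X) (u≢v : u ≢ v)
             (ch : Chain u L v) (uniq : Unique L) (L∉X : ∀ {q} → q ∈ˡ L → q ∉ X) where
    Y = X ∪ fromList L

    L⊆Y : ∀ {q} → q ∈ˡ L → q ∈ Y
    L⊆Y = ∈-∪⁺ʳ ∘ ∈-fromList⁺ L

    L⊆Y-w : ∀ {w q} → q ∈ˡ L → q ≢ w → q ∈ Y - w
    L⊆Y-w q∈L = x∈p∧x≢y⇒x∈p-y (L⊆Y q∈L)

    module _ {pre z suf} (eq : L ≡ pre ++ z ∷ suf) where
      pre⊆L : ∀ {q} → q ∈ˡ pre → q ∈ˡ L
      pre⊆L q∈ = subst (_ ∈ˡ_) (sym eq) (∈-++⁺ˡ q∈)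

      suf⊆L : ∀ {q} → q ∈ˡ suf → q ∈ˡ L
      suf⊆L q∈ = subst (_ ∈ˡ_) (sym eq) (∈-++⁺ʳ pre (there q∈))

      chains : Chain u pre z × Chain z suf v
      chains = Chain-split pre z suf (subst (λ M → Chain u M v) eq ch)

      along-prefix : ∀ {P} → u ∈ P → (∀ {q} → q ∈ˡ pre → q ∈ P) → z ∈ P → Reach G P z u
      along-prefix u∈P pre⊆P z∈P = Reach-sym (Chain⇒Reach pre (proj₁ chains) u∈P pre⊆P z∈P)

      along-suffix : ∀ {P} → z ∈ P → (∀ {q} → q ∈ˡ suf → q ∈ P) → v ∈ P → Reach G P z v
      along-suffix = Chain⇒Reach suf (proj₂ chains)

    X-part : ∀ {w h z} → h ∈ X → h ≢ w → z ∈ X → z ≢ w → Reach G (Y - w) z h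
    X-part {w} h∈X h≢w z∈X z≢w = Reach-mono (p⊆q⇒p-x⊆q-x ∈-∪⁺ˡ)
      (Nonseparable⇒ConnectedOn-minus nsX w _ _ (x∈p∧x≢y⇒x∈p-y z∈X z≢w) (x∈p∧x≢y⇒x∈p-y h∈X h≢w))

    Y-connected : ConnectedOn G Y
    Y-connected = hub⇒ConnectedOn u to-u
      where
      to-u : ∀ z → z ∈ Y → Reach G Y z u
      to-u z z∈Y with ∈-∪⁻ z∈Y
      ... | inj₁ z∈X = Reach-mono ∈-∪⁺ˡ (proj₁ nsX z u z∈X u∈X)
      ... | inj₂ z∈L with ∈-∃++ (∈-fromList⁻ L z∈L)
      ...   | pre , suf , eq = along-prefix eq (∈-∪⁺ˡ u∈X) (L⊆Y ∘ pre⊆L eq) z∈Y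

    -- Without u, ear vertices reach v along their suffixes. Without another w, they reach u along
    -- their prefixes, or, when w lies on the prefix, reach v along the suffix, which misses w.
    Y-no-cut : NoCutVertexOn G Y
    Y-no-cut w _ with u ≟ w
    ... | yes refl = hub⇒ConnectedOn v to-v
      where
      to-v : ∀ z → z ∈ Y - u → Reach G (Y - u) z v
      to-v z z∈ with ∈-∪⁻ (x∈p-y⇒x∈p z∈)
      ... | inj₁ z∈X = X-part v∈X (u≢v ∘ sym) z∈X (x∈p-y⇒x≢y z∈)
      ... | inj₂ z∈L with ∈-∃++ (∈-fromList⁻ L z∈L)
      ...   | pre , suf , eq =
              along-suffix eq z∈ (λ q∈ → L⊆Y-w (suf⊆L eq q∈) λ { refl → L∉X (suf⊆L eq q∈) u∈X })
                (x∈p∧x≢y⇒x∈p-y (∈-∪⁺ˡ v∈X) (u≢v ∘ sym))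
    ... | no u≢w = hub⇒ConnectedOn u to-u
      where
      to-u : ∀ z → z ∈ Y - w → Reach G (Y - w) z u
      to-u z z∈ with ∈-∪⁻ (x∈p-y⇒x∈p z∈)
      ... | inj₁ z∈X = X-part u∈X u≢w z∈X (x∈p-y⇒x≢y z∈)
      ... | inj₂ z∈L with ∈-∃++ (∈-fromList⁻ L z∈L)
      ...   | pre , suf , eq with w ∈ˡ? pre
      ...     | no w∉pre =
                along-prefix eq (x∈p∧x≢y⇒x∈p-y (∈-∪⁺ˡ u∈X) u≢w)
                  (λ q∈ → L⊆Y-w (pre⊆L eq q∈) λ { refl → w∉pre q∈ }) z∈
      ...     | yes w∈pre = Reach-trans (along-suffix eq z∈ suf⊆Y-w (x∈p∧x≢y⇒x∈p-y (∈-∪⁺ˡ v∈X) v≢w))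
                              (X-part u∈X u≢w v∈X v≢w)
        where
        w∉suf : w ∉ˡ suf
        w∉suf = Unique-split pre (subst Unique eq uniq) w∈pre
        suf⊆Y-w : ∀ {q} → q ∈ˡ suf → q ∈ Y - w
        suf⊆Y-w q∈ = L⊆Y-w (suf⊆L eq q∈) λ { refl → w∉suf q∈ }
        v≢w : v ≢ w
        v≢w refl = L∉X (pre⊆L eq w∈pre) v∈X

  ear-Nonseparable : ∀ {X u v} L → Nonseparable G X → u ∈ X → v ∈ X → u ≢ v →
                     Chain u L v → Unique L → (∀ {q} → q ∈ˡ L → q ∉ X) → Nonseparable G (X ∪ fromList L)
  ear-Nonseparable L nsX u∈X v∈X u≢v ch uniq L∉X = Y-connected , Y-no-cut
    where open Ear L nsX u∈X v∈X u≢v ch uniq L∉X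

  block-absorbs : ∀ {E C} → IsBlock G E → E ⊆ C → Nonseparable G C → C ⊆ E
  block-absorbs {E} (_ , maximal) E⊆C nsC {z} z∈C with z ∈? E
  ... | yes z∈E = z∈E
  ... | no  z∉E = ⊥-elim (maximal _ (E⊆C , z , z∈C , z∉E) nsC)

  block-unique : ∀ {E F x y} → IsBlock G E → IsBlock G F → x ∈ E → x ∈ F → y ∈ E → y ∈ F → x ≢ y → E ≡ F
  block-unique bE bF x∈E x∈F y∈E y∈F x≢y =
    ⊆-antisym (λ z∈E → block-absorbs bF ∈-∪⁺ʳ nsE∪F (∈-∪⁺ˡ z∈E))
              (λ z∈F → block-absorbs bE ∈-∪⁺ˡ nsE∪F (∈-∪⁺ʳ z∈F))
    where
    nsE∪F = ∪-Nonseparable (proj₁ bE) (proj₁ bF) x∈E x∈F y∈E y∈F x≢y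

  extend-to-block : ∀ {X} → Nonseparable G X → DoubleNegation (Σ (Subset n) λ E → IsBlock G E × X ⊆ E)
  extend-to-block {X} = go n (m≤n+m n ∣ X ∣)
    where
    shrink : ∀ k {X C} → n ≤ ∣ X ∣ + suc k → X ⊂ C → n ≤ ∣ C ∣ + k
    shrink k n≤ X⊂C = ≤-trans n≤ (≤-trans (≤-reflexive (+-suc _ k)) (+-monoˡ-≤ k (p⊂q⇒∣p∣<∣q∣ X⊂C)))

    go : ∀ k {X} → n ≤ ∣ X ∣ + k → Nonseparable G X → DoubleNegation (Σ (Subset n) λ E → IsBlock G E × X ⊆ E)
    go zero {X} n≤ nsX κ = κ (X , (nsX , λ C X⊂C _ → <⇒≱ (p⊂q⇒∣p∣<∣q∣ X⊂C) (∣C∣≤∣X∣ C)) , id)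
      where
      ∣C∣≤∣X∣ : ∀ C → ∣ C ∣ ≤ ∣ X ∣
      ∣C∣≤∣X∣ C = ≤-trans (∣p∣≤n C) (≤-trans n≤ (≤-reflexive (+-identityʳ _)))
    go (suc k) {X} n≤ nsX κ = ¬¬-excluded-middle λ where
      (no maximal)          → κ (X , (nsX , λ C X⊂C nsC → maximal (C , X⊂C , nsC)) , id)
      (yes (C , X⊂C , nsC)) → go k (shrink k n≤ X⊂C) nsC λ (E , bE , C⊆E) → κ (E , bE , C⊆E ∘ proj₁ X⊂C)

  block-two-vertices : (∀ z → Σ (Fin n) λ w → Adj G w z) → Fin n → ∀ {E} → IsBlock G E →
                       Σ (Fin n) λ x → Σ (Fin n) λ y → x ∈ E × y ∈ E × x ≢ y
  block-two-vertices neighbour v₀ {E} bE with any? (_∈? E)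
  ... | no E-empty =
        ⊥-elim (E-empty (v₀ , block-absorbs bE (λ z∈E → ⊥-elim (E-empty (_ , z∈E)))
                                 (edge-Nonseparable (proj₂ (neighbour v₀))) v∈pair))
  ... | yes (x , x∈E) with any? (λ y → (y ∈? E) ×-dec ¬? (y ≟ x))
  ...   | yes (y , y∈E , y≢x) = x , y , x∈E , y∈E , y≢x ∘ sym
  ...   | no  only-x = ⊥-elim (only-x (w , block-absorbs bE E⊆wx (edge-Nonseparable wx) u∈pair , Adj⇒≢ wx))
    where
    w = proj₁ (neighbour x)
    wx = proj₂ (neighbour x)
    E⊆wx : E ⊆ pair w x
    E⊆wx {z} z∈E with z ≟ x
    ... | yes refl = v∈pair
    ... | no  z≢x  = ⊥-elim (only-x (z , z∈E , z≢x))

  block-no-detour : ∀ {D Q x y v w} → IsBlock G D → y ∈ D → v ∈ D → y ≢ v → (∀ {q} → q ∈ Q → q ∉ D) →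
                    Adj G y x → Reach G Q x w → Adj G w v → ⊥
  block-no-detour {D} {x = x} (nsD , maximal) y∈D v∈D y≢v Q∉D yx r wv
    with Chain-shortcut x (interior r) (Reach⇒Chain r yx wv)
  ... | L , ch , uniq , sub =
        maximal (D ∪ fromList (x ∷ L)) (∈-∪⁺ˡ , x , ∈-∪⁺ʳ (∈-fromList⁺ (x ∷ L) (here refl)) , Q∉D (source∈ r))
                (ear-Nonseparable (x ∷ L) nsD y∈D v∈D y≢v ch uniq λ q∈ → Q∉D (Reach-vertices r (sub q∈)))

  triangle-in-block : ∀ {x y v} → Adj G x y → Adj G v x → Adj G v y →
                      DoubleNegation (Σ (Subset n) λ E → IsBlock G E × x ∈ E × y ∈ E × v ∈ E)
  triangle-in-block {x} {y} {v} xy vx vy κ =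
    extend-to-block triangle λ (E , bE , ⊆E) →
      κ (E , bE , ⊆E (∈-∪⁺ˡ u∈pair) , ⊆E (∈-∪⁺ˡ v∈pair) , ⊆E (∈-∪⁺ʳ (∈-fromList⁺ (v ∷ []) (here refl))))
    where
    v∉xy : ∀ {q} → q ∈ˡ v ∷ [] → q ∉ pair x y
    v∉xy (here refl) q∈ with ∈-pair⁻ q∈
    ... | inj₁ refl = Adj⇒≢ vx refl
    ... | inj₂ refl = Adj⇒≢ vy refl
    triangle : Nonseparable G (pair x y ∪ fromList (v ∷ []))
    triangle = ear-Nonseparable (v ∷ []) (edge-Nonseparable xy) u∈pair v∈pair (Adj⇒≢ xy)
                                (Adj-sym vx , vy) ([] ∷ []) v∉xy

module Convexity {n : ℕ} (G : Graph n) where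
  open Walks G
  open Blocks G

  infix 4 _∈⟪_⟫
  _∈⟪_⟫ : Fin n → Subset n → Set
  v ∈⟪ S ⟫ = _∈⟨_⟩ G v S

  ∈⟪⟫-base : ∀ {v S} → v ∈ S → v ∈⟪ S ⟫
  ∈⟪⟫-base v∈S _ _ S⊆T = S⊆T v∈S

  ∈⟪⟫-trans : ∀ {v S S′} → (∀ {z} → z ∈ S → z ∈⟪ S′ ⟫) → v ∈⟪ S ⟫ → v ∈⟪ S′ ⟫
  ∈⟪⟫-trans S⊆⟪S′⟫ v∈ T convT S′⊆T = v∈ T convT λ z∈S → S⊆⟪S′⟫ z∈S T convT S′⊆T

  CI-⊆ : ∀ {S S′} → S′ ⊆ S → ConvexlyIndependent G S → ConvexlyIndependent G S′
  CI-⊆ S′⊆S ci a a∈S′ a∈ = ci a (S′⊆S a∈S′) (∈⟪⟫-trans (λ z∈ → ∈⟪⟫-base (p⊆q⇒p-x⊆q-x S′⊆S z∈)) a∈)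

  RankBounds : ℕ → Set
  RankBounds d = (∀ S → ConvexlyIndependent G S → ∣ S ∣ ≤ d) ×
                 Σ (Subset n) λ S → ConvexlyIndependent G S × ∣ S ∣ ≡ d

  IsΔRank-intro : ∀ {d} → DoubleNegation (RankBounds d) → IsΔRank G d
  IsΔRank-intro {d} bounds = upper , lower
    where
    upper : ∀ S → d < ∣ S ∣ → ¬ ConvexlyIndependent G S
    upper S d<∣S∣ ci = bounds λ (≤d , _) → <⇒≱ d<∣S∣ (≤d S ci)
    lower : ∀ m → m < d → ¬ (∀ S → m < ∣ S ∣ → ¬ ConvexlyIndependent G S)
    lower m m<d none = bounds λ (_ , S , ci , ∣S∣≡d) → none S (subst (m <_) (sym ∣S∣≡d) m<d) ci

  CIBound : Subset n → ℕ → Set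
  CIBound U m = ∀ S → ConvexlyIndependent G S → S ⊆ U → ∣ S ∣ ≤ m

  BlockClosed : Subset n → Set
  BlockClosed T = ∀ E → IsBlock G E → ∀ {x y} → x ∈ E → y ∈ E → x ≢ y → x ∈ T → y ∈ T → E ⊆ T

  BlockClosed⇒ΔConvex : ∀ {T} → BlockClosed T → ΔConvex G T
  BlockClosed⇒ΔConvex closed v (inj₁ v∈T) = v∈T
  BlockClosed⇒ΔConvex {T} closed v (inj₂ (x , y , x∈T , y∈T , xy , vx , vy)) =
    decidable-stable (v ∈? T) λ v∉T → triangle-in-block xy vx vy λ (E , bE , x∈E , y∈E , v∈E) →
      v∉T (closed E bE x∈E y∈E (Adj⇒≢ xy) x∈T y∈T v∈E)

  record Separator (U S : Subset n) (a : Fin n) : Set where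
    field
      T      : Subset n
      closed : BlockClosed T
      T⊆U    : T ⊆ U
      S-a⊆T  : S - a ⊆ T
      a∉T    : a ∉ T

  Separated : Subset n → Subset n → Set
  Separated U S = ∀ a → a ∈ S → Separator U S a

  Separated⇒CI : ∀ {U S} → Separated U S → ConvexlyIndependent G S
  Separated⇒CI separated a a∈S a∈⟪S-a⟫ = a∉T (a∈⟪S-a⟫ T (BlockClosed⇒ΔConvex closed) S-a⊆T)
    where open Separator (separated a a∈S)

module BlockGraph {n : ℕ} (G : Graph n) (isBG : IsBlockGraph G) where
  open Convexity G

  ∈⟪⟫-block : ∀ {E X x y z} → IsBlock G E → x ∈ E → y ∈ E → z ∈ E → x ≢ y → x ∈⟪ X ⟫ → y ∈⟪ X ⟫ → z ∈⟪ X ⟫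
  ∈⟪⟫-block {E} {x = x} {y} {z} bE x∈E y∈E z∈E x≢y x∈ y∈ T convT X⊆T with z ≟ x | z ≟ y
  ... | yes refl | _        = x∈ T convT X⊆T
  ... | no  _    | yes refl = y∈ T convT X⊆T
  ... | no  z≢x  | no  z≢y  =
        convT z (inj₂ (x , y , x∈ T convT X⊆T , y∈ T convT X⊆T ,
                       adj x∈E y∈E x≢y , adj z∈E x∈E z≢x , adj z∈E y∈E z≢y))
    where
    adj : ∀ {u v} → u ∈ E → v ∈ E → u ≢ v → Adj G u v
    adj = isBG E bE _ _

  CI⇒no-three-in-block : ∀ {S E a b c} → ConvexlyIndependent G S → IsBlock G E →
                         a ∈ E → b ∈ E → c ∈ E → a ∈ S → b ∈ S → c ∈ S → a ≢ b → a ≢ c → b ≢ c → ⊥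
  CI⇒no-three-in-block ci bE a∈E b∈E c∈E a∈S b∈S c∈S a≢b a≢c b≢c =
    ci _ a∈S (∈⟪⟫-block bE b∈E c∈E a∈E b≢c (∈⟪⟫-base (x∈p∧x≢y⇒x∈p-y b∈S (a≢b ∘ sym)))
                                             (∈⟪⟫-base (x∈p∧x≢y⇒x∈p-y c∈S (a≢c ∘ sym))))

  -- Trading two vertices of a block for a third is harmless: each of the three lies in the hull of the
  -- other two.
  CI-swap-pair : ∀ {S D x y v} → ConvexlyIndependent G S → IsBlock G D → x ∈ D → y ∈ D → v ∈ D →
                 x ∈ S → y ∈ S → x ≢ y → v ∉ S → ConvexlyIndependent G ((S - x - y) ∪ ⁅ v ⁆)
  CI-swap-pair {S} {D} {x} {y} {v} ci bD x∈D y∈D v∈D x∈S y∈S x≢y v∉S a a∈S′ a∈⟪⟫ with a ≟ v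
  ... | yes refl = ci x x∈S (∈⟪⟫-block bD v∈D y∈D x∈D v≢y (∈⟪⟫-trans S′-v⊆⟪S-x⟫ a∈⟪⟫) (∈⟪⟫-base y∈S-x))
    where
    v≢y : v ≢ y
    v≢y refl = v∉S y∈S
    y∈S-x : y ∈ S - x
    y∈S-x = x∈p∧x≢y⇒x∈p-y y∈S (x≢y ∘ sym)
    S′-v⊆⟪S-x⟫ : ∀ {z} → z ∈ (S - x - y) ∪ ⁅ v ⁆ - v → z ∈⟪ S - x ⟫
    S′-v⊆⟪S-x⟫ z∈ with ∈-∪⁻ (x∈p-y⇒x∈p z∈)
    ... | inj₁ z∈S-x-y = ∈⟪⟫-base (x∈p-y⇒x∈p z∈S-x-y)
    ... | inj₂ z∈v     = ⊥-elim (x∈p-y⇒x≢y z∈ (x∈⁅y⁆⇒x≡y v z∈v))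
  ... | no a≢v = ci a a∈S (∈⟪⟫-trans S′-a⊆⟪S-a⟫ a∈⟪⟫)
    where
    a∈S-x-y : a ∈ S - x - y
    a∈S-x-y with ∈-∪⁻ a∈S′
    ... | inj₁ a∈ = a∈
    ... | inj₂ a∈v = ⊥-elim (a≢v (x∈⁅y⁆⇒x≡y v a∈v))
    a∈S : a ∈ S
    a∈S = x∈p-y⇒x∈p (x∈p-y⇒x∈p a∈S-x-y)
    S′-a⊆⟪S-a⟫ : ∀ {z} → z ∈ (S - x - y) ∪ ⁅ v ⁆ - a → z ∈⟪ S - a ⟫
    S′-a⊆⟪S-a⟫ z∈ with ∈-∪⁻ (x∈p-y⇒x∈p z∈)
    ... | inj₁ z∈S-x-y = ∈⟪⟫-base (x∈p∧x≢y⇒x∈p-y (x∈p-y⇒x∈p (x∈p-y⇒x∈p z∈S-x-y)) (x∈p-y⇒x≢y z∈))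
    ... | inj₂ z∈v with x∈⁅y⁆⇒x≡y v z∈v
    ...   | refl = ∈⟪⟫-block bD x∈D y∈D v∈D x≢y
                     (∈⟪⟫-base (x∈p∧x≢y⇒x∈p-y x∈S λ { refl → x∈p-y⇒x≢y (x∈p-y⇒x∈p a∈S-x-y) refl }))
                     (∈⟪⟫-base (x∈p∧x≢y⇒x∈p-y y∈S λ { refl → x∈p-y⇒x≢y a∈S-x-y refl }))

module Attachment {n : ℕ} (G : Graph n) (isBG : IsBlockGraph G) {U D : Subset n} {c : Fin n}
                  (connU : ConnectedOn G U) (closedU : Convexity.BlockClosed G U)
                  (bD : IsBlock G D) (c∈D : c ∈ D) (c∈U : c ∈ U) (D∩U⊆c : ∀ {z} → z ∈ D → z ∈ U → z ≡ c) where
  open Walks G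
  open Blocks G
  open Convexity G
  open BlockGraph G isBG

  -- A walk in U back to c, followed by the edge, would be a detour around the block D.
  no-edge-across : ∀ {x y} → x ∈ U → x ∉ D → y ∈ D → y ∉ U → Adj G y x → ⊥
  no-edge-across {x} {y} x∈U x∉D y∈D y∉U yx with Reach-until c (connU x c x∈U c∈U) x≢c
    where
    x≢c : x ≢ c
    x≢c refl = x∉D c∈D
  ... | inj₁ r            = x∈p-y⇒x≢y (source∈ (Reach-sym r)) refl
  ... | inj₂ (w , r , wc) = block-no-detour bD y∈D c∈D (λ { refl → y∉U c∈U }) U-c∉D yx r wc
    where
    U-c∉D : ∀ {q} → q ∈ U - c → q ∉ D
    U-c∉D q∈ q∈D = x∈p-y⇒x≢y q∈ (D∩U⊆c q∈D (x∈p-y⇒x∈p q∈))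

  edge-side-mixed : ∀ {a b} → a ∈ U → b ∈ D → Adj G b a → (a ∈ U × b ∈ U) ⊎ (a ∈ D × b ∈ D)
  edge-side-mixed {a} {b} a∈U b∈D ba with b ∈? U | a ∈? D
  ... | yes b∈U | _       = inj₁ (a∈U , b∈U)
  ... | no  _   | yes a∈D = inj₂ (a∈D , b∈D)
  ... | no  b∉U | no  a∉D = ⊥-elim (no-edge-across a∈U a∉D b∈D b∉U ba)

  edge-side : ∀ {x y} → x ∈ U ∪ D → y ∈ U ∪ D → Adj G x y → (x ∈ U × y ∈ U) ⊎ (x ∈ D × y ∈ D)
  edge-side x∈ y∈ xy with ∈-∪⁻ x∈ | ∈-∪⁻ y∈
  ... | inj₁ x∈U | inj₁ y∈U = inj₁ (x∈U , y∈U)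
  ... | inj₂ x∈D | inj₂ y∈D = inj₂ (x∈D , y∈D)
  ... | inj₁ x∈U | inj₂ y∈D = edge-side-mixed x∈U y∈D (Adj-sym xy)
  ... | inj₂ x∈D | inj₁ y∈U = ⊎-map swap swap (edge-side-mixed y∈U x∈D xy)

  block-meets-twice : ∀ {E x y} → IsBlock G E → x ∈ E → y ∈ E → x ≢ y → x ∈ U ∪ D → y ∈ U ∪ D → E ⊆ U ⊎ E ≡ D
  block-meets-twice {E} bE x∈E y∈E x≢y x∈ y∈ with edge-side x∈ y∈ (isBG E bE _ _ x∈E y∈E x≢y)
  ... | inj₁ (x∈U , y∈U) = inj₁ (closedU E bE x∈E y∈E x≢y x∈U y∈U)
  ... | inj₂ (x∈D , y∈D) = inj₂ (block-unique bE bD x∈E x∈D y∈E y∈D x≢y)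

  U∪D-connected : ConnectedOn G (U ∪ D)
  U∪D-connected = ConnectedOn-glue connU (proj₁ (proj₁ bD)) c∈U c∈D ∈-∪⁺ˡ ∈-∪⁺ʳ id

  U∪D-closed : BlockClosed (U ∪ D)
  U∪D-closed E bE x∈E y∈E x≢y x∈ y∈ with block-meets-twice bE x∈E y∈E x≢y x∈ y∈
  ... | inj₁ E⊆U = λ z∈E → ∈-∪⁺ˡ (E⊆U z∈E)
  ... | inj₂ refl = ∈-∪⁺ʳ

  New : Subset n → Fin n → Set
  New S z = z ∈ S × z ∈ D × z ∉ U

  new? : ∀ S z → Dec (New S z)
  new? S z = (z ∈? S) ×-dec ((z ∈? D) ×-dec ¬? (z ∈? U))

  no-new⇒⊆U : ∀ {S} → S ⊆ U ∪ D → ¬ ∃ (New S) → S ⊆ U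
  no-new⇒⊆U S⊆U∪D no-new {z} z∈S with ∈-∪⁻ (S⊆U∪D z∈S)
  ... | inj₁ z∈U = z∈U
  ... | inj₂ z∈D = decidable-stable (z ∈? U) λ z∉U → no-new (z , z∈S , z∈D , z∉U)

  bound-step : ∀ {m} → CIBound U m → CIBound (U ∪ D) (suc m)
  bound-step {m} bound S ci S⊆U∪D with any? (new? S)
  ... | no no-new = ≤-trans (bound S ci (no-new⇒⊆U S⊆U∪D no-new)) (n≤1+n m)
  ... | yes (x , x∈S , x∈D , x∉U) with any? (new? (S - x))
  ...   | no no-new = subst (_≤ suc m) (sym (x∈p⇒∣p∣≡1+∣p-x∣ x∈S))
                        (s≤s (bound (S - x) (CI-⊆ x∈p-y⇒x∈p ci) (no-new⇒⊆U (S⊆U∪D ∘ x∈p-y⇒x∈p) no-new)))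
  ...   | yes (y , y∈S-x , y∈D , y∉U) =
          subst (_≤ suc m) (sym ∣S∣≡1+∣S′∣)
                (s≤s (bound S′ (CI-swap-pair ci bD x∈D y∈D c∈D x∈S y∈S x≢y c∉S) S′⊆U))
    where
    y∈S = x∈p-y⇒x∈p y∈S-x
    x≢y = x∈p-y⇒x≢y y∈S-x ∘ sym
    three : ∀ {z} → z ∈ D → z ∈ S → x ≢ z → y ≢ z → ⊥
    three z∈D z∈S x≢z y≢z = CI⇒no-three-in-block ci bD x∈D y∈D z∈D x∈S y∈S z∈S x≢y x≢z y≢z
    c∉S : c ∉ S
    c∉S c∈S = three c∈D c∈S (λ { refl → x∉U c∈U }) (λ { refl → y∉U c∈U })
    S₂ = S - x - y
    c∉S₂ : c ∉ S₂
    c∉S₂ c∈S₂ = c∉S (x∈p-y⇒x∈p (x∈p-y⇒x∈p c∈S₂))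
    S′ = S₂ ∪ ⁅ c ⁆
    S₂⊆U : S₂ ⊆ U
    S₂⊆U = no-new⇒⊆U (S⊆U∪D ∘ x∈p-y⇒x∈p ∘ x∈p-y⇒x∈p) λ (z , z∈S₂ , z∈D , _) →
             three z∈D (x∈p-y⇒x∈p (x∈p-y⇒x∈p z∈S₂)) (x∈p-y⇒x≢y (x∈p-y⇒x∈p z∈S₂) ∘ sym) (x∈p-y⇒x≢y z∈S₂ ∘ sym)
    S′⊆U : S′ ⊆ U
    S′⊆U z∈ with ∈-∪⁻ z∈
    ... | inj₁ z∈S₂ = S₂⊆U z∈S₂
    ... | inj₂ z∈c  = subst (_∈ U) (sym (x∈⁅y⁆⇒x≡y c z∈c)) c∈U
    ∣S∣≡1+∣S′∣ : ∣ S ∣ ≡ suc ∣ S′ ∣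
    ∣S∣≡1+∣S′∣ = let open ≡-Reasoning in begin
      ∣ S ∣             ≡⟨ x∈p⇒∣p∣≡1+∣p-x∣ x∈S ⟩
      suc ∣ S - x ∣     ≡⟨ cong suc (x∈p⇒∣p∣≡1+∣p-x∣ y∈S-x) ⟩
      suc (suc ∣ S₂ ∣)  ≡⟨ cong suc (sym (x∉p⇒∣p∪⁅x⁆∣≡1+∣p∣ c∉S₂)) ⟩
      suc ∣ S′ ∣        ∎

  closed-extension : ∀ {T T′} → BlockClosed T → T ⊆ T′ → T′ ⊆ U ∪ D → (∀ {z} → z ∈ U → z ∈ T′ → z ∈ T) →
                     (∀ {x y} → x ∈ D → y ∈ D → x ≢ y → x ∈ T′ → y ∈ T′ → D ⊆ T′) → BlockClosed T′
  closed-extension closedT T⊆T′ T′⊆U∪D back D-case E bE x∈E y∈E x≢y x∈T′ y∈T′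
    with block-meets-twice bE x∈E y∈E x≢y (T′⊆U∪D x∈T′) (T′⊆U∪D y∈T′)
  ... | inj₁ E⊆U  = λ z∈E → T⊆T′ (closedT E bE x∈E y∈E x≢y (back (E⊆U x∈E) x∈T′) (back (E⊆U y∈E) y∈T′) z∈E)
  ... | inj₂ refl = D-case x∈E y∈E x≢y x∈T′ y∈T′

  module _ {d : Fin n} (d∈D : d ∈ D) (d∉U : d ∉ U) where

    S∪d-a⊆ : ∀ {S a T T′} → S - a ⊆ T → T ⊆ T′ → d ∈ T′ → (S ∪ ⁅ d ⁆) - a ⊆ T′
    S∪d-a⊆ S-a⊆T T⊆T′ d∈T′ z∈ with ∈-∪⁻ (x∈p-y⇒x∈p z∈)
    ... | inj₁ z∈S = T⊆T′ (S-a⊆T (x∈p∧x≢y⇒x∈p-y z∈S (x∈p-y⇒x≢y z∈)))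
    ... | inj₂ z∈d = subst (_∈ _) (sym (x∈⁅y⁆⇒x≡y d z∈d)) d∈T′

    separator-new : ∀ {S} → S ⊆ U → Separator (U ∪ D) (S ∪ ⁅ d ⁆) d
    separator-new {S} S⊆U = record { T = U ; closed = closedU ; T⊆U = ∈-∪⁺ˡ ; S-a⊆T = S′-d⊆U ; a∉T = d∉U }
      where
      S′-d⊆U : (S ∪ ⁅ d ⁆) - d ⊆ U
      S′-d⊆U z∈ with ∈-∪⁻ (x∈p-y⇒x∈p z∈)
      ... | inj₁ z∈S = S⊆U z∈S
      ... | inj₂ z∈d = ⊥-elim (x∈p-y⇒x≢y z∈ (x∈⁅y⁆⇒x≡y d z∈d))

    separator-through-c : ∀ {S a} → a ∈ U → (sep : Separator U S a) → c ∈ Separator.T sep →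
                          Separator (U ∪ D) (S ∪ ⁅ d ⁆) a
    separator-through-c a∈U sep c∈T = record
      { T      = T ∪ D
      ; closed = closed-extension closed ∈-∪⁺ˡ T∪D⊆U∪D back λ _ _ _ _ _ → ∈-∪⁺ʳ
      ; T⊆U    = T∪D⊆U∪D
      ; S-a⊆T  = S∪d-a⊆ S-a⊆T ∈-∪⁺ˡ (∈-∪⁺ʳ d∈D)
      ; a∉T    = a∉T ∘ back a∈U
      }
      where
      open Separator sep
      T∪D⊆U∪D : T ∪ D ⊆ U ∪ D
      T∪D⊆U∪D z∈ with ∈-∪⁻ z∈
      ... | inj₁ z∈T = ∈-∪⁺ˡ (T⊆U z∈T)
      ... | inj₂ z∈D = ∈-∪⁺ʳ z∈D
      back : ∀ {z} → z ∈ U → z ∈ T ∪ D → z ∈ T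
      back z∈U z∈ with ∈-∪⁻ z∈
      ... | inj₁ z∈T = z∈T
      ... | inj₂ z∈D = subst (_∈ T) (sym (D∩U⊆c z∈D z∈U)) c∈T

    separator-avoiding-c : ∀ {S a} → a ∈ U → (sep : Separator U S a) → c ∉ Separator.T sep →
                           Separator (U ∪ D) (S ∪ ⁅ d ⁆) a
    separator-avoiding-c a∈U sep c∉T = record
      { T      = T ∪ ⁅ d ⁆
      ; closed = closed-extension closed ∈-∪⁺ˡ T∪d⊆U∪D back λ x∈D y∈D x≢y x∈ y∈ →
                   ⊥-elim (x≢y (trans (only-d x∈D x∈) (sym (only-d y∈D y∈))))
      ; T⊆U    = T∪d⊆U∪D
      ; S-a⊆T  = S∪d-a⊆ S-a⊆T ∈-∪⁺ˡ (∈-∪⁺ʳ (x∈⁅x⁆ d))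
      ; a∉T    = a∉T ∘ back a∈U
      }
      where
      open Separator sep
      T∪d⊆U∪D : T ∪ ⁅ d ⁆ ⊆ U ∪ D
      T∪d⊆U∪D z∈ with ∈-∪⁻ z∈
      ... | inj₁ z∈T = ∈-∪⁺ˡ (T⊆U z∈T)
      ... | inj₂ z∈d = ∈-∪⁺ʳ (subst (_∈ D) (sym (x∈⁅y⁆⇒x≡y d z∈d)) d∈D)
      back : ∀ {z} → z ∈ U → z ∈ T ∪ ⁅ d ⁆ → z ∈ T
      back z∈U z∈ with ∈-∪⁻ z∈
      ... | inj₁ z∈T = z∈T
      ... | inj₂ z∈d = ⊥-elim (d∉U (subst (_∈ U) (x∈⁅y⁆⇒x≡y d z∈d) z∈U))
      only-d : ∀ {z} → z ∈ D → z ∈ T ∪ ⁅ d ⁆ → z ≡ d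
      only-d z∈D z∈ with ∈-∪⁻ z∈
      ... | inj₁ z∈T = ⊥-elim (c∉T (subst (_∈ T) (D∩U⊆c z∈D (T⊆U z∈T)) z∈T))
      ... | inj₂ z∈d = x∈⁅y⁆⇒x≡y d z∈d

    separated-step : ∀ {S} → S ⊆ U → Separated U S → Separated (U ∪ D) (S ∪ ⁅ d ⁆)
    separated-step S⊆U separated a a∈ with a ≟ d | ∈-∪⁻ a∈
    ... | yes refl | _        = separator-new S⊆U
    ... | no  a≢d  | inj₂ a∈d = ⊥-elim (a≢d (x∈⁅y⁆⇒x≡y d a∈d))
    ... | no  _    | inj₁ a∈S with c ∈? Separator.T (separated a a∈S)
    ...   | yes c∈T = separator-through-c (S⊆U a∈S) (separated a a∈S) c∈T
    ...   | no  c∉T = separator-avoiding-c (S⊆U a∈S) (separated a a∈S) c∉T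

module Growth {n : ℕ} (G : Graph n) (connG : Connected G) (isBG : IsBlockGraph G)
              (neighbour : ∀ z → Σ (Fin n) λ w → Adj G w z) (v₀ : Fin n)
              (ℓ : ℕ) (B : Fin ℓ → Subset n) (B-injective : Injective _≡_ _≡_ B)
              (B-blocks : ∀ i → IsBlock G (B i)) (B-all : ∀ C → IsBlock G C → ∃ λ i → B i ≡ C) where
  open Walks G
  open Blocks G
  open Convexity G

  record Stage (k : ℕ) : Set where
    field
      U         : Subset n
      root      : Fin n
      root∈U    : root ∈ U
      connected : ConnectedOn G U
      closed    : BlockClosed U
      I         : Subset ℓ
      ∣I∣≡k     : ∣ I ∣ ≡ k
      ∈I⇒B⊆U    : ∀ {i} → i ∈ I → B i ⊆ U
      B⊆U⇒∈I    : ∀ i → B i ⊆ U → i ∈ I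
      bound     : CIBound U (suc k)
      S         : Subset n
      S⊆U       : S ⊆ U
      ∣S∣≡1+k   : ∣ S ∣ ≡ suc k
      separated : Separated U S

  Spanning : ∀ {k} → Stage k → Set
  Spanning s = ∀ v → v ∈ Stage.U s

  stage₀ : Stage 0
  stage₀ = record
    { U         = ⁅ v₀ ⁆
    ; root      = v₀
    ; root∈U    = x∈⁅x⁆ v₀
    ; connected = λ x y x∈ y∈ → subst (Reach G ⁅ v₀ ⁆ x) (∈⁅⁆-unique x∈ y∈) (here x∈)
    ; closed    = λ _ _ _ _ x≢y x∈ y∈ → ⊥-elim (x≢y (∈⁅⁆-unique x∈ y∈))
    ; I         = ∅
    ; ∣I∣≡k     = ∣⊥∣≡0 ℓ
    ; ∈I⇒B⊆U    = λ i∈∅ → ⊥-elim (∉⊥ i∈∅)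
    ; B⊆U⇒∈I    = λ i Bi⊆ → ⊥-elim (not-in-singleton (B-blocks i) Bi⊆)
    ; bound     = λ X _ X⊆ → ≤-trans (p⊆q⇒∣p∣≤∣q∣ X⊆) (≤-reflexive (∣⁅x⁆∣≡1 v₀))
    ; S         = ⁅ v₀ ⁆
    ; S⊆U       = id
    ; ∣S∣≡1+k   = ∣⁅x⁆∣≡1 v₀
    ; separated = λ a a∈ → record
        { T      = ∅
        ; closed = λ _ _ _ _ _ x∈∅ _ → ⊥-elim (∉⊥ x∈∅)
        ; T⊆U    = λ z∈∅ → ⊥-elim (∉⊥ z∈∅)
        ; S-a⊆T  = λ z∈ → ⊥-elim (x∈p-y⇒x≢y z∈ (∈⁅⁆-unique (x∈p-y⇒x∈p z∈) a∈))
        ; a∉T    = ∉⊥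
        }
    }
    where
    not-in-singleton : ∀ {E} → IsBlock G E → ¬ (E ⊆ ⁅ v₀ ⁆)
    not-in-singleton bE E⊆ with block-two-vertices neighbour v₀ bE
    ... | x , y , x∈E , y∈E , x≢y = x≢y (∈⁅⁆-unique (E⊆ x∈E) (E⊆ y∈E))

  Stage⇒k≤ℓ : ∀ {k} → Stage k → k ≤ ℓ
  Stage⇒k≤ℓ s = subst (_≤ ℓ) (Stage.∣I∣≡k s) (∣p∣≤n (Stage.I s))

  grow : ∀ {k} (s : Stage k) b → b ∉ Stage.U s → DoubleNegation (Stage (suc k))
  grow {k} s b b∉U κ with Reach-exit U (connG root b ∈⊤ ∈⊤) root∈U b∉U
    where open Stage s
  ... | c , d , c∈U , d∉U , cd =
        extend-to-block (edge-Nonseparable cd) λ (D , bD , cd⊆D) → κ (attach bD (cd⊆D u∈pair) (cd⊆D v∈pair))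
    where
    open Stage s
    attach : ∀ {D} → IsBlock G D → c ∈ D → d ∈ D → Stage (suc k)
    attach {D} bD c∈D d∈D = record
      { U         = U ∪ D
      ; root      = root
      ; root∈U    = ∈-∪⁺ˡ root∈U
      ; connected = U∪D-connected
      ; closed    = U∪D-closed
      ; I         = I ∪ ⁅ j ⁆
      ; ∣I∣≡k     = trans (x∉p⇒∣p∪⁅x⁆∣≡1+∣p∣ j∉I) (cong suc ∣I∣≡k)
      ; ∈I⇒B⊆U    = ∈I′⇒B⊆U′
      ; B⊆U⇒∈I    = B⊆U′⇒∈I′
      ; bound     = bound-step bound
      ; S         = S ∪ ⁅ d ⁆
      ; S⊆U       = S′⊆U′
      ; ∣S∣≡1+k   = trans (x∉p⇒∣p∪⁅x⁆∣≡1+∣p∣ (d∉U ∘ S⊆U)) (cong suc ∣S∣≡1+k)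
      ; separated = separated-step d∈D d∉U S⊆U separated
      }
      where
      D∩U⊆c : ∀ {z} → z ∈ D → z ∈ U → z ≡ c
      D∩U⊆c {z} z∈D z∈U with z ≟ c
      ... | yes z≡c = z≡c
      ... | no  z≢c = ⊥-elim (d∉U (closed D bD z∈D c∈D z≢c z∈U c∈U d∈D))
      open Attachment G isBG connected closed bD c∈D c∈U D∩U⊆c
      j = proj₁ (B-all D bD)
      Bj≡D = proj₂ (B-all D bD)
      j∉I : j ∉ I
      j∉I j∈I = d∉U (subst (_⊆ U) Bj≡D (∈I⇒B⊆U j∈I) d∈D)
      ∈I′⇒B⊆U′ : ∀ {i} → i ∈ I ∪ ⁅ j ⁆ → B i ⊆ U ∪ D
      ∈I′⇒B⊆U′ i∈ with ∈-∪⁻ i∈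
      ... | inj₁ i∈I = ∈-∪⁺ˡ ∘ ∈I⇒B⊆U i∈I
      ... | inj₂ i∈j rewrite x∈⁅y⁆⇒x≡y j i∈j | Bj≡D = ∈-∪⁺ʳ
      B⊆U′⇒∈I′ : ∀ i → B i ⊆ U ∪ D → i ∈ I ∪ ⁅ j ⁆
      B⊆U′⇒∈I′ i Bi⊆ with block-two-vertices neighbour v₀ (B-blocks i)
      ... | x , y , x∈ , y∈ , x≢y with block-meets-twice (B-blocks i) x∈ y∈ x≢y (Bi⊆ x∈) (Bi⊆ y∈)
      ...   | inj₁ Bi⊆U = ∈-∪⁺ˡ (B⊆U⇒∈I i Bi⊆U)
      ...   | inj₂ Bi≡D rewrite B-injective (trans Bi≡D (sym Bj≡D)) = ∈-∪⁺ʳ (x∈⁅x⁆ j)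
      S′⊆U′ : S ∪ ⁅ d ⁆ ⊆ U ∪ D
      S′⊆U′ z∈ with ∈-∪⁻ z∈
      ... | inj₁ z∈S = ∈-∪⁺ˡ (S⊆U z∈S)
      ... | inj₂ z∈d = ∈-∪⁺ʳ (subst (_∈ D) (sym (x∈⁅y⁆⇒x≡y d z∈d)) d∈D)

  spanning-stage : ∀ fuel {k} → fuel + k ≡ ℓ → Stage k → DoubleNegation (Σ ℕ λ k → Σ (Stage k) Spanning)
  spanning-stage fuel {k} fuel+k≡ℓ s κ with any? (λ v → ¬? (v ∈? Stage.U s))
  ... | no  none        = κ (k , s , λ v → decidable-stable (v ∈? Stage.U s) λ v∉U → none (v , v∉U))
  ... | yes (b , b∉U) = grow s b b∉U (continue fuel fuel+k≡ℓ)
    where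
    continue : ∀ fuel → fuel + k ≡ ℓ → Stage (suc k) → ⊥
    continue zero       k≡ℓ        s′ = 1+n≰n (subst (suc k ≤_) (sym k≡ℓ) (Stage⇒k≤ℓ s′))
    continue (suc fuel) 1+fuel+k≡ℓ s′ = spanning-stage fuel (trans (+-suc fuel k) 1+fuel+k≡ℓ) s′ κ

  spanning⇒bounds : ∀ {k} (s : Stage k) → Spanning s → RankBounds (suc ℓ)
  spanning⇒bounds s spans =
      (λ X ci → subst (λ m → ∣ X ∣ ≤ suc m) k≡ℓ (bound X ci λ {v} _ → spans v))
    , S , Separated⇒CI separated , trans ∣S∣≡1+k (cong suc k≡ℓ)
    where
    open Stage s
    k≡ℓ = trans (sym ∣I∣≡k) (∀∈⇒∣p∣≡n λ i → B⊆U⇒∈I i λ {v} _ → spans v)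

  bounds : DoubleNegation (RankBounds (suc ℓ))
  bounds = ¬¬-map (λ (_ , s , spans) → spanning⇒bounds s spans) (spanning-stage ℓ (+-identityʳ ℓ) stage₀)

connected⇒neighbour : ∀ {m} (G : Graph (suc (suc m))) → Connected G →
                      ∀ z → Σ (Fin (suc (suc m))) λ w → Adj G w z
connected⇒neighbour G conn z with z ≟ zero
... | yes refl = Walks.Reach-last-edge G (conn (suc zero) zero ∈⊤ ∈⊤) λ ()
... | no  z≢0  = Walks.Reach-last-edge G (conn zero z ∈⊤ ∈⊤) (z≢0 ∘ sym)

theorem7 : ∀ {n} (G : Graph n) → 2 ≤ n → Connected G → IsBlockGraph G →
           ∀ (ℓ : ℕ) (B : Fin ℓ → Subset n) →
           Injective _≡_ _≡_ B →
           (∀ i → IsBlock G (B i)) →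
           (∀ C → IsBlock G C → ∃ λ i → B i ≡ C) →
           IsΔRank G (suc ℓ)
theorem7 {suc (suc _)} G (s≤s (s≤s _)) connG isBG ℓ B B-injective B-blocks B-all =
  Convexity.IsΔRank-intro G
    (Growth.bounds G connG isBG (connected⇒neighbour G connG) zero ℓ B B-injective B-blocks B-all)
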